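{- For every positive integer $n$, $$N_n(t)=\frac{1}{4n+2}\sum_{k=1}^{n-1}k(n-k)\binom{2n+2}{2k+1}t^k.$$
   Context: For nonnegative integers $p,q$ let $W_{pq}(t)=\sum_{k=0}^{\min\{p,q\}-1}\binom{p-1}{k}\binom{q-1}{k}t^k$. Define polynomials $N_{pq}(t)$ for nonnegative integers $p,q$ by $N_{0,q}=N_{p,0}=N_{1,1}=0$ and, for $p,q\ge1$ with $(p,q)\neq(1,1)$, $$N_{pq}=N_{p-1,q}+N_{p,q-1}-(1-t)N_{p-1,q-1}+|p-q|\,t\,W_{pq}.$$ Write $N_n(t)=N_{nn}(t)$. -}

module Defs where

open import Data.Nat as ℕ using (ℕ; zero; suc; _<ᵇ_; _≤ᵇ_; _∸_; ∣_-_∣)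
open import Data.Nat.Combinatorics using (_C_)
open import Data.Integer as ℤ using (ℤ; +_; 0ℤ)
open import Data.Bool using (if_then_else_)

-- A polynomial in t with integer coefficients, represented by its
-- coefficient function: (f k) is the coefficient of t^k.
Poly : Set
Poly = ℕ → ℤ

0ₚ : Poly
0ₚ _ = 0ℤ

_⊕_ : Poly → Poly → Poly
(f ⊕ g) k = f k ℤ.+ g k

_⊖_ : Poly → Poly → Poly
(f ⊖ g) k = f k ℤ.- g k

_·_ : ℤ → Poly → Poly
(c · f) k = c ℤ.* f k

t* : Poly → Poly
t* f zero    = 0ℤ
t* f (suc k) = f k

[1-t]* : Poly → Poly
[1-t]* f = f ⊖ t* f

W : ℕ → ℕ → Poly
W p q k = if k <ᵇ ℕ._⊓_ p q then + (((p ∸ 1) C k) ℕ.* ((q ∸ 1) C k)) else 0ℤ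

N : ℕ → ℕ → Poly
N zero          q             = 0ₚ
N (suc p)       zero          = 0ₚ
N (suc zero)    (suc zero)    = 0ₚ
N (suc p)       (suc q)       =
  ((N p (suc q) ⊕ N (suc p) q) ⊖ [1-t]* (N p q))
    ⊕ ((+ ∣ suc p - suc q ∣) · t* (W (suc p) (suc q)))

Nₙ : ℕ → Poly
Nₙ n = N n n

rhsCoeff : ℕ → Poly
rhsCoeff n k =
  if (1 ≤ᵇ k) Data.Bool.∧ (k ≤ᵇ n ∸ 1)
  then + (k ℕ.* (n ∸ k) ℕ.* ((2 ℕ.* n ℕ.+ 2) C (2 ℕ.* k ℕ.+ 1)))
  else 0ℤ

{-# OPTIONS --safe #-}
module Submission where

-- For p ≤ q the coefficients of N_pq have an explicit form Ñ p q: a binomial convolution R minus a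
-- correction T_k D.  Ñ satisfies the recurrence defining N, vanishes for p = 0 and agrees across
-- the diagonal (Ñ (p+1) p = Ñ p (p+1)); since N is symmetric, induction gives N = Ñ for p ≤ q.
-- On the diagonal the correction vanishes, and reflecting the summation index of R n n k about
-- k + 1/2 turns 2 R n n k into a sum weighted by (i − k)(i − k − 1), which Vandermonde's identity
-- and its first two factorial moments evaluate.

open import Defs
open import Data.Nat using (ℕ; _≥_; _+_; _*_)
open import Data.Integer using (+_) renaming (_*_ to _*ℤ_)
open import Relation.Binary.PropositionalEquality using (_≡_)

open import Data.Nat using (zero; suc; _∸_; _<_; _≤_; z≤n; s≤s; _⊓_; _<ᵇ_; _≤ᵇ_; _≤?_; ∣_-_∣)
open import Data.Bool using (T; true; false)
open import Data.Sum using (_⊎_; inj₁; inj₂)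
open import Relation.Nullary using (yes; no)
import Data.Nat.Properties as ℕ
open import Data.Nat.Combinatorics using (_C_; nCk+nC[k+1]≡[n+1]C[k+1]; k>n⇒nCk≡0; nCk≡nC[n∸k]; nCn≡1)
open import Data.Integer using (ℤ; 0ℤ; 1ℤ) renaming (_+_ to _+ℤ_; _-_ to _-ℤ_; -_ to -ℤ_)
import Data.Integer.Properties as ℤ
open import Data.Integer.Tactic.RingSolver using (solve; solve-∀)
open import Data.Nat.Tactic.RingSolver using () renaming (solve-∀ to solve-∀-ℕ)
open import Data.List using (_∷_; [])
open import Relation.Binary.PropositionalEquality
  using (refl; sym; trans; cong; cong₂; subst; _≗_; module ≡-Reasoning)
open ≡-Reasoning
open import Algebra.Properties.CommutativeSemigroup ℤ.+-commutativeSemigroup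
  using () renaming (interchange to +-interchange)

∑ : ℕ → (ℕ → ℤ) → ℤ
∑ zero    f = 0ℤ
∑ (suc n) f = ∑ n f +ℤ f n

∑-cong-< : ∀ n {f g : ℕ → ℤ} → (∀ j → j < n → f j ≡ g j) → ∑ n f ≡ ∑ n g
∑-cong-< zero    eq = refl
∑-cong-< (suc n) eq = cong₂ _+ℤ_ (∑-cong-< n (λ j j<n → eq j (ℕ.m<n⇒m<1+n j<n))) (eq n ℕ.≤-refl)

∑-cong : ∀ n {f g : ℕ → ℤ} → f ≗ g → ∑ n f ≡ ∑ n g
∑-cong n eq = ∑-cong-< n (λ j _ → eq j)

∑-zero : ∀ n {f : ℕ → ℤ} → (∀ j → j < n → f j ≡ 0ℤ) → ∑ n f ≡ 0ℤ
∑-zero zero    eq = refl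
∑-zero (suc n) eq = cong₂ _+ℤ_ (∑-zero n (λ j j<n → eq j (ℕ.m<n⇒m<1+n j<n))) (eq n ℕ.≤-refl)

∑-distrib-+ : ∀ n (f g : ℕ → ℤ) → ∑ n (λ j → f j +ℤ g j) ≡ ∑ n f +ℤ ∑ n g
∑-distrib-+ zero    f g = refl
∑-distrib-+ (suc n) f g = begin
  ∑ n (λ j → f j +ℤ g j) +ℤ (f n +ℤ g n) ≡⟨ cong (_+ℤ (f n +ℤ g n)) (∑-distrib-+ n f g) ⟩
  (∑ n f +ℤ ∑ n g) +ℤ (f n +ℤ g n)        ≡⟨ +-interchange (∑ n f) (∑ n g) (f n) (g n) ⟩
  (∑ n f +ℤ f n) +ℤ (∑ n g +ℤ g n)        ∎

∑-distrib-- : ∀ n (f g : ℕ → ℤ) → ∑ n (λ j → f j -ℤ g j) ≡ ∑ n f -ℤ ∑ n g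
∑-distrib-- zero    f g = refl
∑-distrib-- (suc n) f g = begin
  ∑ n (λ j → f j -ℤ g j) +ℤ (f n -ℤ g n) ≡⟨ cong (_+ℤ (f n -ℤ g n)) (∑-distrib-- n f g) ⟩
  (∑ n f -ℤ ∑ n g) +ℤ (f n -ℤ g n)        ≡⟨ interchange-- (∑ n f) (∑ n g) (f n) (g n) ⟩
  (∑ n f +ℤ f n) -ℤ (∑ n g +ℤ g n)        ∎
  where
  interchange-- : ∀ a b c d → (a -ℤ b) +ℤ (c -ℤ d) ≡ (a +ℤ c) -ℤ (b +ℤ d)
  interchange-- = solve-∀

*-distribˡ-∑ : ∀ n c (f : ℕ → ℤ) → c *ℤ ∑ n f ≡ ∑ n (λ j → c *ℤ f j)
*-distribˡ-∑ zero    c f = ℤ.*-zeroʳ c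
*-distribˡ-∑ (suc n) c f =
  trans (ℤ.*-distribˡ-+ c (∑ n f) (f n)) (cong (_+ℤ c *ℤ f n) (*-distribˡ-∑ n c f))

∑-sucˡ : ∀ n (f : ℕ → ℤ) → ∑ (suc n) f ≡ f 0 +ℤ ∑ n (λ j → f (suc j))
∑-sucˡ zero    f = ℤ.+-comm 0ℤ (f 0)
∑-sucˡ (suc n) f = trans (cong (_+ℤ f (suc n)) (∑-sucˡ n f)) (ℤ.+-assoc (f 0) _ _)

∑-split : ∀ a b (f : ℕ → ℤ) → ∑ (a + b) f ≡ ∑ a f +ℤ ∑ b (λ j → f (a + j))
∑-split a zero    f = trans (cong (λ m → ∑ m f) (ℕ.+-identityʳ a)) (sym (ℤ.+-identityʳ (∑ a f)))
∑-split a (suc b) f = begin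
  ∑ (a + suc b) f                          ≡⟨ cong (λ m → ∑ m f) (ℕ.+-suc a b) ⟩
  ∑ (a + b) f +ℤ f (a + b)                 ≡⟨ cong (_+ℤ f (a + b)) (∑-split a b f) ⟩
  ∑ a f +ℤ ∑ b (λ j → f (a + j)) +ℤ f (a + b) ≡⟨ ℤ.+-assoc (∑ a f) _ _ ⟩
  ∑ a f +ℤ ∑ (suc b) (λ j → f (a + j))     ∎

∑-reverse : ∀ n (f : ℕ → ℤ) → ∑ n f ≡ ∑ n (λ j → f (n ∸ suc j))
∑-reverse zero    f = refl
∑-reverse (suc n) f = begin
  ∑ n f +ℤ f n                                ≡⟨ cong (_+ℤ f n) (∑-reverse n f) ⟩
  ∑ n (λ j → f (n ∸ suc j)) +ℤ f n            ≡⟨ ℤ.+-comm _ (f n) ⟩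
  f n +ℤ ∑ n (λ j → f (suc n ∸ suc (suc j)))  ≡⟨ ∑-sucˡ n (λ j → f (suc n ∸ suc j)) ⟨
  ∑ (suc n) (λ j → f (suc n ∸ suc j))         ∎

∑-telescope : ∀ n (V : ℕ → ℤ) → ∑ n (λ j → V (suc j) -ℤ V j) ≡ V n -ℤ V 0
∑-telescope zero    V = sym (ℤ.+-inverseʳ (V 0))
∑-telescope (suc n) V = begin
  ∑ n (λ j → V (suc j) -ℤ V j) +ℤ (V (suc n) -ℤ V n)
    ≡⟨ cong (_+ℤ (V (suc n) -ℤ V n)) (∑-telescope n V) ⟩
  (V n -ℤ V 0) +ℤ (V (suc n) -ℤ V n)
    ≡⟨ ℤ.+-comm (V n -ℤ V 0) _ ⟩
  (V (suc n) -ℤ V n) +ℤ (V n -ℤ V 0)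
    ≡⟨ ℤ.+-minus-telescope (V (suc n)) (V n) (V 0) ⟩
  V (suc n) -ℤ V 0 ∎

∑-mixedDiff : ∀ n (f g h u : ℕ → ℤ) →
  (∑ n f -ℤ ∑ n g) -ℤ (∑ n h -ℤ ∑ n u) ≡ ∑ n (λ j → (f j -ℤ g j) -ℤ (h j -ℤ u j))
∑-mixedDiff n f g h u = begin
  (∑ n f -ℤ ∑ n g) -ℤ (∑ n h -ℤ ∑ n u)
    ≡⟨ cong₂ _-ℤ_ (∑-distrib-- n f g) (∑-distrib-- n h u) ⟨
  ∑ n (λ j → f j -ℤ g j) -ℤ ∑ n (λ j → h j -ℤ u j)
    ≡⟨ ∑-distrib-- n _ _ ⟨
  ∑ n (λ j → (f j -ℤ g j) -ℤ (h j -ℤ u j)) ∎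

binom : ℕ → ℕ → ℤ
binom n       zero    = 1ℤ
binom zero    (suc k) = 0ℤ
binom (suc n) (suc k) = binom n k +ℤ binom n (suc k)

binom≡C : ∀ n k → binom n k ≡ + (n C k)
binom≡C n       zero    = cong +_ (sym (trans (nCk≡nC[n∸k] {0} {n} z≤n) (nCn≡1 n)))
binom≡C zero    (suc k) = cong +_ (sym (k>n⇒nCk≡0 {0} {suc k} (s≤s z≤n)))
binom≡C (suc n) (suc k) =
  trans (cong₂ _+ℤ_ (binom≡C n k) (binom≡C n (suc k))) (cong +_ (nCk+nC[k+1]≡[n+1]C[k+1] n k))

n<k⇒binom≡0 : ∀ {n k} → n < k → binom n k ≡ 0ℤ
n<k⇒binom≡0 {zero}  {suc k} _         = refl
n<k⇒binom≡0 {suc n} {suc k} (s≤s n<k) =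
  cong₂ _+ℤ_ (n<k⇒binom≡0 n<k) (n<k⇒binom≡0 (ℕ.m<n⇒m<1+n n<k))

binom-1 : ∀ n → binom n 1 ≡ + n
binom-1 zero    = refl
binom-1 (suc n) = cong (1ℤ +ℤ_) (binom-1 n)

binom-next : ∀ n k → + suc k *ℤ binom n (suc k) +ℤ + k *ℤ binom n k ≡ + n *ℤ binom n k
binom-next zero    zero    = refl
binom-next zero    (suc k) = cong₂ _+ℤ_ (ℤ.*-zeroʳ (+ suc (suc k))) (ℤ.*-zeroʳ (+ suc k))
binom-next (suc n) zero    = begin
  1ℤ *ℤ binom (suc n) 1 +ℤ 0ℤ ≡⟨ ℤ.+-identityʳ _ ⟩
  1ℤ *ℤ binom (suc n) 1       ≡⟨ ℤ.*-identityˡ _ ⟩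
  binom (suc n) 1             ≡⟨ binom-1 (suc n) ⟩
  + suc n                     ≡⟨ ℤ.*-identityʳ _ ⟨
  + suc n *ℤ 1ℤ               ∎
binom-next (suc n) (suc k) =
  step (+ k) (+ n) (binom n k) (binom n (suc k)) (binom n (suc (suc k)))
       (binom-next n (suc k)) (binom-next n k)
  where
  step : ∀ k n c₀ c₁ c₂ →
    (1ℤ +ℤ (1ℤ +ℤ k)) *ℤ c₂ +ℤ (1ℤ +ℤ k) *ℤ c₁ ≡ n *ℤ c₁ →
    (1ℤ +ℤ k) *ℤ c₁ +ℤ k *ℤ c₀ ≡ n *ℤ c₀ →
    (1ℤ +ℤ (1ℤ +ℤ k)) *ℤ (c₁ +ℤ c₂) +ℤ (1ℤ +ℤ k) *ℤ (c₀ +ℤ c₁) ≡ (1ℤ +ℤ n) *ℤ (c₀ +ℤ c₁)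
  step k n c₀ c₁ c₂ e₁ e₀ = begin
    (1ℤ +ℤ (1ℤ +ℤ k)) *ℤ (c₁ +ℤ c₂) +ℤ (1ℤ +ℤ k) *ℤ (c₀ +ℤ c₁)
      ≡⟨ solve (k ∷ c₀ ∷ c₁ ∷ c₂ ∷ []) ⟩
    ((1ℤ +ℤ (1ℤ +ℤ k)) *ℤ c₂ +ℤ (1ℤ +ℤ k) *ℤ c₁) +ℤ ((1ℤ +ℤ k) *ℤ c₁ +ℤ k *ℤ c₀) +ℤ (c₀ +ℤ c₁)
      ≡⟨ cong₂ (λ a b → a +ℤ b +ℤ (c₀ +ℤ c₁)) e₁ e₀ ⟩
    n *ℤ c₁ +ℤ n *ℤ c₀ +ℤ (c₀ +ℤ c₁)
      ≡⟨ solve (n ∷ c₀ ∷ c₁ ∷ []) ⟩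
    (1ℤ +ℤ n) *ℤ (c₀ +ℤ c₁) ∎

binom-absorb : ∀ n k → + suc k *ℤ binom (suc n) (suc k) ≡ + suc n *ℤ binom n k
binom-absorb n k = absorb (+ k) (+ n) (binom n k) (binom n (suc k)) (binom-next n k)
  where
  absorb : ∀ k n c₀ c₁ → (1ℤ +ℤ k) *ℤ c₁ +ℤ k *ℤ c₀ ≡ n *ℤ c₀ →
    (1ℤ +ℤ k) *ℤ (c₀ +ℤ c₁) ≡ (1ℤ +ℤ n) *ℤ c₀
  absorb k n c₀ c₁ e = begin
    (1ℤ +ℤ k) *ℤ (c₀ +ℤ c₁)              ≡⟨ solve (k ∷ c₀ ∷ c₁ ∷ []) ⟩
    c₀ +ℤ ((1ℤ +ℤ k) *ℤ c₁ +ℤ k *ℤ c₀)   ≡⟨ cong (c₀ +ℤ_) e ⟩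
    c₀ +ℤ n *ℤ c₀                        ≡⟨ solve (n ∷ c₀ ∷ []) ⟩
    (1ℤ +ℤ n) *ℤ c₀                      ∎

-- binom∸ m k i = C(m, k − i), and 0 when i > k: the coefficient of tᵏ in tⁱ (1 + t)ᵐ.
binom∸ : ℕ → ℕ → ℕ → ℤ
binom∸ m k       zero    = binom m k
binom∸ m zero    (suc i) = 0ℤ
binom∸ m (suc k) (suc i) = binom∸ m k i

binom∸-pascal : ∀ m k i → binom∸ (suc m) k i ≡ binom∸ m k i +ℤ binom∸ m k (suc i)
binom∸-pascal m zero    zero    = refl
binom∸-pascal m (suc k) zero    = ℤ.+-comm (binom m k) (binom m (suc k))
binom∸-pascal m zero    (suc i) = refl
binom∸-pascal m (suc k) (suc i) = binom∸-pascal m k i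

k<i⇒binom∸≡0 : ∀ m {k i} → k < i → binom∸ m k i ≡ 0ℤ
k<i⇒binom∸≡0 m {zero}  {suc i} _         = refl
k<i⇒binom∸≡0 m {suc k} {suc i} (s≤s k<i) = k<i⇒binom∸≡0 m k<i

i≤k⇒binom∸≡binom : ∀ m {k i} → i ≤ k → binom∸ m k i ≡ binom m (k ∸ i)
i≤k⇒binom∸≡binom m {k}     {zero}  _         = refl
i≤k⇒binom∸≡binom m {suc k} {suc i} (s≤s i≤k) = i≤k⇒binom∸≡binom m i≤k

binom∸-absorb : ∀ m k j →
  + suc m *ℤ binom∸ m k (suc j) +ℤ + j *ℤ binom∸ (suc m) k j ≡ + k *ℤ binom∸ (suc m) k j
binom∸-absorb m zero    zero    = cong (_+ℤ 0ℤ) (ℤ.*-zeroʳ (+ suc m))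
binom∸-absorb m (suc k) zero    = trans (ℤ.+-identityʳ _) (sym (binom-absorb m k))
binom∸-absorb m zero    (suc j) = cong₂ _+ℤ_ (ℤ.*-zeroʳ (+ suc m)) (ℤ.*-zeroʳ (+ suc j))
binom∸-absorb m (suc k) (suc j) =
  step (+ suc m) (+ j) (+ k) (binom∸ m k (suc j)) (binom∸ (suc m) k j) (binom∸-absorb m k j)
  where
  step : ∀ m j k x y → m *ℤ x +ℤ j *ℤ y ≡ k *ℤ y → m *ℤ x +ℤ (1ℤ +ℤ j) *ℤ y ≡ (1ℤ +ℤ k) *ℤ y
  step m j k x y e = begin
    m *ℤ x +ℤ (1ℤ +ℤ j) *ℤ y ≡⟨ solve (m ∷ j ∷ x ∷ y ∷ []) ⟩
    (m *ℤ x +ℤ j *ℤ y) +ℤ y  ≡⟨ cong (_+ℤ y) e ⟩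
    k *ℤ y +ℤ y              ≡⟨ solve (k ∷ y ∷ []) ⟩
    (1ℤ +ℤ k) *ℤ y           ∎

W-binom : ∀ p q k → W (suc p) (suc q) k ≡ binom p k *ℤ binom q k
W-binom p q k with k <ᵇ suc (p ⊓ q) in eq
... | true  = sym (trans (cong₂ _*ℤ_ (binom≡C p k) (binom≡C q k)) (ℤ.pos-distrib-* (p C k) (q C k)))
... | false = sym (vanishes (ℕ.⊓-sel p q))
  where
  min<k : p ⊓ q < k
  min<k = ℕ.≰⇒> (λ k≤min → subst T eq (ℕ.<⇒<ᵇ (s≤s k≤min)))
  vanishes : (p ⊓ q ≡ p) ⊎ (p ⊓ q ≡ q) → binom p k *ℤ binom q k ≡ 0ℤ
  vanishes (inj₁ e) = cong (_*ℤ binom q k) (n<k⇒binom≡0 (subst (_< k) e min<k))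
  vanishes (inj₂ e) =
    trans (cong (binom p k *ℤ_) (n<k⇒binom≡0 (subst (_< k) e min<k))) (ℤ.*-zeroʳ (binom p k))

t*-cong : ∀ {f g : Poly} → f ≗ g → t* f ≗ t* g
t*-cong eq zero    = refl
t*-cong eq (suc k) = eq k

t*-⊖ : ∀ (f g : Poly) k → t* (f ⊖ g) k ≡ t* f k -ℤ t* g k
t*-⊖ f g zero    = refl
t*-⊖ f g (suc k) = refl

Nstep : ℕ → ℕ → Poly → Poly → Poly → Poly
Nstep p q X₀₁ X₁₀ X₀₀ = ((X₀₁ ⊕ X₁₀) ⊖ [1-t]* X₀₀) ⊕ ((+ ∣ p - q ∣) · t* (W (suc p) (suc q)))

N-step : ∀ p q → N (suc p) (suc q) ≗ Nstep p q (N p (suc q)) (N (suc p) q) (N p q)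
N-step zero    zero    zero    = refl
N-step zero    zero    (suc k) = refl
N-step zero    (suc q) k       = refl
N-step (suc p) zero    k       = refl
N-step (suc p) (suc q) k       = refl

Nstep-cong : ∀ p q {X₀₁ X₁₀ X₀₀ Y₀₁ Y₁₀ Y₀₀ : Poly} → X₀₁ ≗ Y₀₁ → X₁₀ ≗ Y₁₀ → X₀₀ ≗ Y₀₀ →
  Nstep p q X₀₁ X₁₀ X₀₀ ≗ Nstep p q Y₀₁ Y₁₀ Y₀₀
Nstep-cong p q e₀₁ e₁₀ e₀₀ k =
  cong (_+ℤ _) (cong₂ _-ℤ_ (cong₂ _+ℤ_ (e₀₁ k) (e₁₀ k)) (cong₂ _-ℤ_ (e₀₀ k) (t*-cong e₀₀ k)))

Nstep-swap : ∀ p q (X Y Z : Poly) → Nstep p q X Y Z ≗ Nstep q p Y X Z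
Nstep-swap p q X Y Z k =
  cong₂ (λ a b → (a -ℤ [1-t]* Z k) +ℤ b) (ℤ.+-comm (X k) (Y k))
        (cong₂ (λ d w → + d *ℤ w) (ℕ.∣-∣-comm p q) (t*-cong W-swap k))
  where
  W-swap : W (suc p) (suc q) ≗ W (suc q) (suc p)
  W-swap j = trans (W-binom p q j) (trans (ℤ.*-comm (binom p j) (binom q j)) (sym (W-binom q p j)))

N-sym : ∀ p q → N p q ≗ N q p
N-sym zero    zero    k = refl
N-sym zero    (suc q) k = refl
N-sym (suc p) zero    k = refl
N-sym (suc p) (suc q) k = begin
  N (suc p) (suc q) k
    ≡⟨ N-step p q k ⟩
  Nstep p q (N p (suc q)) (N (suc p) q) (N p q) k
    ≡⟨ Nstep-cong p q (N-sym p (suc q)) (N-sym (suc p) q) (N-sym p q) k ⟩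
  Nstep p q (N (suc q) p) (N q (suc p)) (N q p) k
    ≡⟨ Nstep-swap p q (N (suc q) p) (N q (suc p)) (N q p) k ⟩
  Nstep q p (N q (suc p)) (N (suc q) p) (N q p) k
    ≡⟨ N-step q p k ⟨
  N (suc q) (suc p) k ∎

Δ² : (ℕ → ℕ → Poly) → ℕ → ℕ → Poly
Δ² X p q = (X (suc p) (suc q) ⊖ X p (suc q)) ⊖ (X (suc p) q ⊖ X p q)

Δ²-⊖ : ∀ (X Y : ℕ → ℕ → Poly) p q k →
  Δ² (λ a b → X a b ⊖ Y a b) p q k ≡ Δ² X p q k -ℤ Δ² Y p q k
Δ²-⊖ X Y p q k =
  difference (X (suc p) (suc q) k) (X p (suc q) k) (X (suc p) q k) (X p q k)
             (Y (suc p) (suc q) k) (Y p (suc q) k) (Y (suc p) q k) (Y p q k)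
  where
  difference : ∀ a b c d e f g h →
    ((a -ℤ e) -ℤ (b -ℤ f)) -ℤ ((c -ℤ g) -ℤ (d -ℤ h)) ≡ ((a -ℤ b) -ℤ (c -ℤ d)) -ℤ ((e -ℤ f) -ℤ (g -ℤ h))
  difference = solve-∀

triangle : ℕ → ℤ
triangle zero    = 0ℤ
triangle (suc k) = triangle k +ℤ + suc k

-- For p ≤ q the coefficient of tᵏ in N_pq is Ñ p q k = R p q k − T_k D p q k, where T_k = k(k+1)/2,
--   R p q k = Σ_{j<k} (j+1)(j+2) C(p+1, k+j+2) C(q+1, k−j−1),
--   D p q k = C(p, k+1) C(q+1, k+1) − C(p+1, k+1) C(q, k+1).
R-summand : ℕ → ℕ → ℕ → ℕ → ℤ
R-summand p q k j =
  + suc j *ℤ + suc (suc j) *ℤ (binom (suc p) (suc (suc (k + j))) *ℤ binom∸ (suc q) k (suc j))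

R : ℕ → ℕ → Poly
R p q k = ∑ k (R-summand p q k)

D : ℕ → ℕ → Poly
D p q k = binom p (suc k) *ℤ binom (suc q) (suc k) -ℤ binom (suc p) (suc k) *ℤ binom q (suc k)

S : ℕ → ℕ → Poly
S p q k = triangle k *ℤ D p q k

Ñ : ℕ → ℕ → Poly
Ñ p q = R p q ⊖ S p q

R-summand-Δ² : ∀ p q k j →
  (R-summand (suc p) (suc q) (suc k) j -ℤ R-summand p (suc q) (suc k) j)
    -ℤ (R-summand (suc p) q (suc k) j -ℤ R-summand p q (suc k) j)
  ≡ R-summand p q k j
R-summand-Δ² p q k j =
  bilinear (+ suc j *ℤ + suc (suc j))
    (binom (suc p) (suc (suc (k + j)))) (binom (suc p) (suc (suc (suc (k + j)))))
    (binom∸ (suc q) k j) (binom∸ (suc q) k (suc j)) _ (binom∸-pascal (suc q) k j)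
  where
  bilinear : ∀ w x₁ x₂ y₁ y₂ y → y ≡ y₁ +ℤ y₂ →
    (w *ℤ ((x₁ +ℤ x₂) *ℤ y) -ℤ w *ℤ (x₂ *ℤ y)) -ℤ (w *ℤ ((x₁ +ℤ x₂) *ℤ y₁) -ℤ w *ℤ (x₂ *ℤ y₁))
    ≡ w *ℤ (x₁ *ℤ y₂)
  bilinear w x₁ x₂ y₁ y₂ _ refl = solve (w ∷ x₁ ∷ x₂ ∷ y₁ ∷ y₂ ∷ [])

R-Δ² : ∀ p q k → Δ² R p q k ≡ t* (R p q) k
R-Δ² p q zero    = refl
R-Δ² p q (suc k) = begin
  Δ² R p q (suc k)                    ≡⟨ ∑-mixedDiff (suc k) _ _ _ _ ⟩
  ∑ (suc k) (λ j → (R-summand (suc p) (suc q) (suc k) j -ℤ R-summand p (suc q) (suc k) j)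
                     -ℤ (R-summand (suc p) q (suc k) j -ℤ R-summand p q (suc k) j))
                                      ≡⟨ ∑-cong (suc k) (R-summand-Δ² p q k) ⟩
  R p q k +ℤ R-summand p q k k        ≡⟨ cong (R p q k +ℤ_) last-vanishes ⟩
  R p q k +ℤ 0ℤ                       ≡⟨ ℤ.+-identityʳ (R p q k) ⟩
  R p q k                             ∎
  where
  last-vanishes : R-summand p q k k ≡ 0ℤ
  last-vanishes = begin
    w *ℤ (x *ℤ binom∸ (suc q) k (suc k))
      ≡⟨ cong (λ y → w *ℤ (x *ℤ y)) (k<i⇒binom∸≡0 (suc q) (ℕ.n<1+n k)) ⟩
    w *ℤ (x *ℤ 0ℤ)                       ≡⟨ cong (w *ℤ_) (ℤ.*-zeroʳ x) ⟩
    w *ℤ 0ℤ                              ≡⟨ ℤ.*-zeroʳ w ⟩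
    0ℤ                                   ∎
    where
    w = + suc k *ℤ + suc (suc k)
    x = binom (suc p) (suc (suc (k + k)))

D-Δ² : ∀ p q k → Δ² D p q (suc k) ≡ D p q k
D-Δ² p q k = identity (binom p k) (binom p (suc k)) (binom p (suc (suc k)))
                      (binom q k) (binom q (suc k)) (binom q (suc (suc k)))
  where
  identity : ∀ x₀ x₁ x₂ y₀ y₁ y₂ →
    ((x₁ +ℤ x₂) *ℤ ((y₀ +ℤ y₁) +ℤ (y₁ +ℤ y₂)) -ℤ ((x₀ +ℤ x₁) +ℤ (x₁ +ℤ x₂)) *ℤ (y₁ +ℤ y₂)
      -ℤ (x₂ *ℤ ((y₀ +ℤ y₁) +ℤ (y₁ +ℤ y₂)) -ℤ (x₁ +ℤ x₂) *ℤ (y₁ +ℤ y₂)))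
    -ℤ ((x₁ +ℤ x₂) *ℤ (y₁ +ℤ y₂) -ℤ ((x₀ +ℤ x₁) +ℤ (x₁ +ℤ x₂)) *ℤ y₂
      -ℤ (x₂ *ℤ (y₁ +ℤ y₂) -ℤ (x₁ +ℤ x₂) *ℤ y₂))
    ≡ x₁ *ℤ (y₀ +ℤ y₁) -ℤ (x₀ +ℤ x₁) *ℤ y₁
  identity = solve-∀

D-scaled : ∀ p q k → + suc k *ℤ D p q k ≡ (+ p -ℤ + q) *ℤ (binom p k *ℤ binom q k)
D-scaled p q k =
  scaled (+ k) (+ p) (+ q) (binom p k) (binom p (suc k)) (binom q k) (binom q (suc k))
         (binom-next p k) (binom-next q k)
  where
  scaled : ∀ k p q x₀ x₁ y₀ y₁ →
    (1ℤ +ℤ k) *ℤ x₁ +ℤ k *ℤ x₀ ≡ p *ℤ x₀ → (1ℤ +ℤ k) *ℤ y₁ +ℤ k *ℤ y₀ ≡ q *ℤ y₀ →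
    (1ℤ +ℤ k) *ℤ (x₁ *ℤ (y₀ +ℤ y₁) -ℤ (x₀ +ℤ x₁) *ℤ y₁) ≡ (p -ℤ q) *ℤ (x₀ *ℤ y₀)
  scaled k p q x₀ x₁ y₀ y₁ ex ey = begin
    (1ℤ +ℤ k) *ℤ (x₁ *ℤ (y₀ +ℤ y₁) -ℤ (x₀ +ℤ x₁) *ℤ y₁)
      ≡⟨ solve (k ∷ x₀ ∷ x₁ ∷ y₀ ∷ y₁ ∷ []) ⟩
    ((1ℤ +ℤ k) *ℤ x₁ +ℤ k *ℤ x₀) *ℤ y₀ -ℤ x₀ *ℤ ((1ℤ +ℤ k) *ℤ y₁ +ℤ k *ℤ y₀)
      ≡⟨ cong₂ (λ a b → a *ℤ y₀ -ℤ x₀ *ℤ b) ex ey ⟩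
    (p *ℤ x₀) *ℤ y₀ -ℤ x₀ *ℤ (q *ℤ y₀)
      ≡⟨ solve (p ∷ q ∷ x₀ ∷ y₀ ∷ []) ⟩
    (p -ℤ q) *ℤ (x₀ *ℤ y₀) ∎

S-Δ² : ∀ p q k → Δ² S p q k ≡ t* (S p q) k +ℤ (+ p -ℤ + q) *ℤ t* (W (suc p) (suc q)) k
S-Δ² p q zero    = sym (trans (ℤ.+-identityˡ _) (ℤ.*-zeroʳ (+ p -ℤ + q)))
S-Δ² p q (suc k) = begin
  Δ² S p q (suc k)
    ≡⟨ factor (triangle (suc k)) _ _ _ _ ⟩
  triangle (suc k) *ℤ Δ² D p q (suc k)
    ≡⟨ cong (triangle (suc k) *ℤ_) (D-Δ² p q k) ⟩
  (triangle k +ℤ + suc k) *ℤ D p q k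
    ≡⟨ ℤ.*-distribʳ-+ (D p q k) (triangle k) (+ suc k) ⟩
  S p q k +ℤ + suc k *ℤ D p q k
    ≡⟨ cong (S p q k +ℤ_) (D-scaled p q k) ⟩
  S p q k +ℤ (+ p -ℤ + q) *ℤ (binom p k *ℤ binom q k)
    ≡⟨ cong (λ w → S p q k +ℤ (+ p -ℤ + q) *ℤ w) (W-binom p q k) ⟨
  S p q k +ℤ (+ p -ℤ + q) *ℤ W (suc p) (suc q) k ∎
  where
  factor : ∀ c a b d e → (c *ℤ a -ℤ c *ℤ b) -ℤ (c *ℤ d -ℤ c *ℤ e) ≡ c *ℤ ((a -ℤ b) -ℤ (d -ℤ e))
  factor = solve-∀

Ñ-Δ² : ∀ p q k → Δ² Ñ p q k ≡ t* (Ñ p q) k +ℤ (+ q -ℤ + p) *ℤ t* (W (suc p) (suc q)) k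
Ñ-Δ² p q k = begin
  Δ² Ñ p q k                                    ≡⟨ Δ²-⊖ R S p q k ⟩
  Δ² R p q k -ℤ Δ² S p q k                      ≡⟨ cong₂ _-ℤ_ (R-Δ² p q k) (S-Δ² p q k) ⟩
  t* (R p q) k -ℤ (t* (S p q) k +ℤ (+ p -ℤ + q) *ℤ w)
                                                ≡⟨ regroup (t* (R p q) k) (t* (S p q) k) (+ p) (+ q) w ⟩
  (t* (R p q) k -ℤ t* (S p q) k) +ℤ (+ q -ℤ + p) *ℤ w
                                                ≡⟨ cong (_+ℤ (+ q -ℤ + p) *ℤ w) (t*-⊖ (R p q) (S p q) k) ⟨
  t* (Ñ p q) k +ℤ (+ q -ℤ + p) *ℤ w             ∎
  where
  w = t* (W (suc p) (suc q)) k
  regroup : ∀ r s p q w → r -ℤ (s +ℤ (p -ℤ q) *ℤ w) ≡ (r -ℤ s) +ℤ (q -ℤ p) *ℤ w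
  regroup = solve-∀

Ñ-step : ∀ {p q} → p ≤ q → Ñ (suc p) (suc q) ≗ Nstep p q (Ñ p (suc q)) (Ñ (suc p) q) (Ñ p q)
Ñ-step {p} {q} p≤q k = begin
  Ñ (suc p) (suc q) k
    ≡⟨ solveFor₁₁ _ _ _ _ _ _ (Ñ-Δ² p q k) ⟩
  base +ℤ (+ q -ℤ + p) *ℤ w
    ≡⟨ cong (λ c → base +ℤ c *ℤ w) distance ⟨
  Nstep p q (Ñ p (suc q)) (Ñ (suc p) q) (Ñ p q) k ∎
  where
  w = t* (W (suc p) (suc q)) k
  base = (Ñ p (suc q) k +ℤ Ñ (suc p) q k) -ℤ (Ñ p q k -ℤ t* (Ñ p q) k)
  distance : + ∣ p - q ∣ ≡ + q -ℤ + p
  distance = trans (cong +_ (ℕ.m≤n⇒∣m-n∣≡n∸m p≤q)) (sym (trans (ℤ.m-n≡m⊖n q p) (ℤ.⊖-≥ p≤q)))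
  solveFor₁₁ : ∀ x₁₁ x₀₁ x₁₀ x₀₀ y e → (x₁₁ -ℤ x₀₁) -ℤ (x₁₀ -ℤ x₀₀) ≡ y +ℤ e →
    x₁₁ ≡ (x₀₁ +ℤ x₁₀) -ℤ (x₀₀ -ℤ y) +ℤ e
  solveFor₁₁ x₁₁ x₀₁ x₁₀ x₀₀ y e eq = begin
    x₁₁                                                    ≡⟨ solve (x₁₁ ∷ x₀₁ ∷ x₁₀ ∷ x₀₀ ∷ []) ⟩
    ((x₁₁ -ℤ x₀₁) -ℤ (x₁₀ -ℤ x₀₀)) +ℤ (x₀₁ +ℤ x₁₀ -ℤ x₀₀) ≡⟨ cong (_+ℤ (x₀₁ +ℤ x₁₀ -ℤ x₀₀)) eq ⟩
    (y +ℤ e) +ℤ (x₀₁ +ℤ x₁₀ -ℤ x₀₀)                        ≡⟨ solve (x₀₁ ∷ x₁₀ ∷ x₀₀ ∷ y ∷ e ∷ []) ⟩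
    (x₀₁ +ℤ x₁₀) -ℤ (x₀₀ -ℤ y) +ℤ e                        ∎

Ñ-zeroˡ : ∀ q → Ñ 0 q ≗ 0ₚ
Ñ-zeroˡ q zero    = refl
Ñ-zeroˡ q (suc k) =
  cong₂ _-ℤ_ (∑-zero (suc k) (λ j _ → ℤ.*-zeroʳ (+ suc j *ℤ + suc (suc j)))) (ℤ.*-zeroʳ (triangle (suc k)))

R-summand-comm : ∀ p q k j → R-summand p q k j
  ≡ + suc j *ℤ + suc (suc j) *ℤ (binom (suc p) (suc (suc (j + k))) *ℤ binom∸ (suc q) k (suc j))
R-summand-comm p q k j =
  cong (λ i → + suc j *ℤ + suc (suc j) *ℤ (binom (suc p) (suc (suc i)) *ℤ binom∸ (suc q) k (suc j)))
       (ℕ.+-comm k j)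

R-skew-potential : ℕ → ℕ → ℕ → ℤ
R-skew-potential p k j =
  + j *ℤ + suc j *ℤ (binom (suc p) (suc (j + k)) *ℤ binom∸ (suc p) k (suc j))
    +ℤ + suc p *ℤ (binom p (j + k) *ℤ binom∸ p k (suc j))

R-skew-step : ∀ p k j →
  R-summand p (suc p) k j -ℤ R-summand (suc p) p k j ≡ R-skew-potential p k (suc j) -ℤ R-skew-potential p k j
R-skew-step p k j =
  trans (cong₂ _-ℤ_ (R-summand-comm p (suc p) k j) (R-summand-comm (suc p) p k j))
        (step (+ j) (+ k) (+ suc p)
              (binom p (j + k)) (binom p (suc (j + k))) (binom∸ p k (suc j)) (binom∸ p k (suc (suc j)))
              (binom (suc p) (suc (suc (j + k)))) (binom∸ (suc p) k (suc (suc j)))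
              _ _ (binom∸-pascal p k (suc j)) (binom∸-pascal (suc p) k (suc j))
              (binom-absorb p (j + k)) (binom∸-absorb p k (suc j)))
  where
  step : ∀ j k m x y u v z z′ s s′ → s ≡ u +ℤ v → s′ ≡ s +ℤ z′ →
    (1ℤ +ℤ (j +ℤ k)) *ℤ (x +ℤ y) ≡ m *ℤ x → m *ℤ v +ℤ (1ℤ +ℤ j) *ℤ s ≡ k *ℤ s →
    (1ℤ +ℤ j) *ℤ (1ℤ +ℤ (1ℤ +ℤ j)) *ℤ (z *ℤ s′) -ℤ (1ℤ +ℤ j) *ℤ (1ℤ +ℤ (1ℤ +ℤ j)) *ℤ (((x +ℤ y) +ℤ z) *ℤ s)
    ≡ ((1ℤ +ℤ j) *ℤ (1ℤ +ℤ (1ℤ +ℤ j)) *ℤ (z *ℤ z′) +ℤ m *ℤ (y *ℤ v))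
        -ℤ (j *ℤ (1ℤ +ℤ j) *ℤ ((x +ℤ y) *ℤ s) +ℤ m *ℤ (x *ℤ u))
  step j k m x y u v z z′ _ _ refl refl e₁ e₂ = begin
    (1ℤ +ℤ j) *ℤ (1ℤ +ℤ (1ℤ +ℤ j)) *ℤ (z *ℤ ((u +ℤ v) +ℤ z′))
      -ℤ (1ℤ +ℤ j) *ℤ (1ℤ +ℤ (1ℤ +ℤ j)) *ℤ (((x +ℤ y) +ℤ z) *ℤ (u +ℤ v))
      ≡⟨ solve (j ∷ k ∷ m ∷ x ∷ y ∷ u ∷ v ∷ z ∷ z′ ∷ []) ⟩
    (1ℤ +ℤ j) *ℤ (1ℤ +ℤ (1ℤ +ℤ j)) *ℤ (z *ℤ z′) -ℤ j *ℤ (1ℤ +ℤ j) *ℤ ((x +ℤ y) *ℤ (u +ℤ v))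
      -ℤ (((1ℤ +ℤ (j +ℤ k)) *ℤ (x +ℤ y)) *ℤ (u +ℤ v) -ℤ (x +ℤ y) *ℤ (k *ℤ (u +ℤ v))
          +ℤ (x +ℤ y) *ℤ ((1ℤ +ℤ j) *ℤ (u +ℤ v)))
      ≡⟨ cong₂ (λ a b → (1ℤ +ℤ j) *ℤ (1ℤ +ℤ (1ℤ +ℤ j)) *ℤ (z *ℤ z′) -ℤ j *ℤ (1ℤ +ℤ j) *ℤ ((x +ℤ y) *ℤ (u +ℤ v))
                          -ℤ (a *ℤ (u +ℤ v) -ℤ (x +ℤ y) *ℤ b +ℤ (x +ℤ y) *ℤ ((1ℤ +ℤ j) *ℤ (u +ℤ v)))) e₁ (sym e₂) ⟩
    (1ℤ +ℤ j) *ℤ (1ℤ +ℤ (1ℤ +ℤ j)) *ℤ (z *ℤ z′) -ℤ j *ℤ (1ℤ +ℤ j) *ℤ ((x +ℤ y) *ℤ (u +ℤ v))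
      -ℤ ((m *ℤ x) *ℤ (u +ℤ v) -ℤ (x +ℤ y) *ℤ (m *ℤ v +ℤ (1ℤ +ℤ j) *ℤ (u +ℤ v))
          +ℤ (x +ℤ y) *ℤ ((1ℤ +ℤ j) *ℤ (u +ℤ v)))
      ≡⟨ solve (j ∷ m ∷ x ∷ y ∷ u ∷ v ∷ z ∷ z′ ∷ []) ⟩
    ((1ℤ +ℤ j) *ℤ (1ℤ +ℤ (1ℤ +ℤ j)) *ℤ (z *ℤ z′) +ℤ m *ℤ (y *ℤ v))
      -ℤ (j *ℤ (1ℤ +ℤ j) *ℤ ((x +ℤ y) *ℤ (u +ℤ v)) +ℤ m *ℤ (x *ℤ u)) ∎

R-skew : ∀ p k → R p (suc p) k -ℤ R (suc p) p k ≡ -ℤ (+ suc p *ℤ (binom p k *ℤ binom∸ p k 1))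
R-skew p k = begin
  R p (suc p) k -ℤ R (suc p) p k
    ≡⟨ ∑-distrib-- k (R-summand p (suc p) k) (R-summand (suc p) p k) ⟨
  ∑ k (λ j → R-summand p (suc p) k j -ℤ R-summand (suc p) p k j)
    ≡⟨ ∑-cong k (R-skew-step p k) ⟩
  ∑ k (λ j → V (suc j) -ℤ V j)
    ≡⟨ ∑-telescope k V ⟩
  V k -ℤ V 0
    ≡⟨ cong₂ _-ℤ_ V-last (ℤ.+-identityˡ E) ⟩
  0ℤ -ℤ E
    ≡⟨ ℤ.+-identityˡ (-ℤ E) ⟩
  -ℤ E ∎
  where
  V = R-skew-potential p k
  E = + suc p *ℤ (binom p k *ℤ binom∸ p k 1)
  vanish : ∀ c x {m} → binom∸ m k (suc k) ≡ 0ℤ → c *ℤ (x *ℤ binom∸ m k (suc k)) ≡ 0ℤ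
  vanish c x e = trans (cong (λ y → c *ℤ (x *ℤ y)) e) (trans (cong (c *ℤ_) (ℤ.*-zeroʳ x)) (ℤ.*-zeroʳ c))
  V-last : V k ≡ 0ℤ
  V-last = cong₂ _+ℤ_
    (vanish (+ k *ℤ + suc k) (binom (suc p) (suc (k + k))) (k<i⇒binom∸≡0 (suc p) (ℕ.n<1+n k)))
    (vanish (+ suc p) (binom p (k + k)) (k<i⇒binom∸≡0 p (ℕ.n<1+n k)))

triangle-double : ∀ k → triangle k +ℤ triangle k ≡ + k *ℤ + suc k
triangle-double zero    = refl
triangle-double (suc k) = step (triangle k) (+ k) (triangle-double k)
  where
  step : ∀ t k → t +ℤ t ≡ k *ℤ (1ℤ +ℤ k) →
    (t +ℤ (1ℤ +ℤ k)) +ℤ (t +ℤ (1ℤ +ℤ k)) ≡ (1ℤ +ℤ k) *ℤ (1ℤ +ℤ (1ℤ +ℤ k))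
  step t k e = begin
    (t +ℤ (1ℤ +ℤ k)) +ℤ (t +ℤ (1ℤ +ℤ k)) ≡⟨ solve (t ∷ k ∷ []) ⟩
    (t +ℤ t) +ℤ (1ℤ +ℤ k) *ℤ (1ℤ +ℤ 1ℤ)  ≡⟨ cong (_+ℤ (1ℤ +ℤ k) *ℤ (1ℤ +ℤ 1ℤ)) e ⟩
    k *ℤ (1ℤ +ℤ k) +ℤ (1ℤ +ℤ k) *ℤ (1ℤ +ℤ 1ℤ) ≡⟨ solve (k ∷ []) ⟩
    (1ℤ +ℤ k) *ℤ (1ℤ +ℤ (1ℤ +ℤ k))       ∎

S-skew : ∀ p k → S p (suc p) k -ℤ S (suc p) p k ≡ -ℤ (+ suc p *ℤ (binom p k *ℤ binom∸ p k 1))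
S-skew p zero    = sym (cong -ℤ_ (ℤ.*-zeroʳ (+ suc p)))
S-skew p (suc k) =
  skew (triangle (suc k)) (+ k) (+ p) (binom p k) (binom p (suc k)) (binom p (suc (suc k)))
       (triangle-double (suc k)) (binom-next p k) (binom-next p (suc k))
  where
  skew : ∀ t k p x y z → t +ℤ t ≡ (1ℤ +ℤ k) *ℤ (1ℤ +ℤ (1ℤ +ℤ k)) →
    (1ℤ +ℤ k) *ℤ y +ℤ k *ℤ x ≡ p *ℤ x → (1ℤ +ℤ (1ℤ +ℤ k)) *ℤ z +ℤ (1ℤ +ℤ k) *ℤ y ≡ p *ℤ y →
    t *ℤ (z *ℤ ((x +ℤ y) +ℤ (y +ℤ z)) -ℤ (y +ℤ z) *ℤ (y +ℤ z))
      -ℤ t *ℤ ((y +ℤ z) *ℤ (y +ℤ z) -ℤ ((x +ℤ y) +ℤ (y +ℤ z)) *ℤ z)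
    ≡ -ℤ ((1ℤ +ℤ p) *ℤ (y *ℤ x))
  skew t k p x y z eₜ e₀ e₁ = begin
    t *ℤ (z *ℤ ((x +ℤ y) +ℤ (y +ℤ z)) -ℤ (y +ℤ z) *ℤ (y +ℤ z))
      -ℤ t *ℤ ((y +ℤ z) *ℤ (y +ℤ z) -ℤ ((x +ℤ y) +ℤ (y +ℤ z)) *ℤ z)
      ≡⟨ solve (t ∷ x ∷ y ∷ z ∷ []) ⟩
    (t +ℤ t) *ℤ (x *ℤ z -ℤ y *ℤ y)
      ≡⟨ cong (_*ℤ (x *ℤ z -ℤ y *ℤ y)) eₜ ⟩
    (1ℤ +ℤ k) *ℤ (1ℤ +ℤ (1ℤ +ℤ k)) *ℤ (x *ℤ z -ℤ y *ℤ y)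
      ≡⟨ solve (k ∷ x ∷ y ∷ z ∷ []) ⟩
    (1ℤ +ℤ k) *ℤ x *ℤ ((1ℤ +ℤ (1ℤ +ℤ k)) *ℤ z +ℤ (1ℤ +ℤ k) *ℤ y) -ℤ (1ℤ +ℤ k) *ℤ (1ℤ +ℤ k) *ℤ x *ℤ y
      -ℤ (1ℤ +ℤ (1ℤ +ℤ k)) *ℤ y *ℤ ((1ℤ +ℤ k) *ℤ y +ℤ k *ℤ x) +ℤ k *ℤ (1ℤ +ℤ (1ℤ +ℤ k)) *ℤ x *ℤ y
      ≡⟨ cong₂ (λ a b → (1ℤ +ℤ k) *ℤ x *ℤ a -ℤ (1ℤ +ℤ k) *ℤ (1ℤ +ℤ k) *ℤ x *ℤ y
                          -ℤ (1ℤ +ℤ (1ℤ +ℤ k)) *ℤ y *ℤ b +ℤ k *ℤ (1ℤ +ℤ (1ℤ +ℤ k)) *ℤ x *ℤ y) e₁ e₀ ⟩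
    (1ℤ +ℤ k) *ℤ x *ℤ (p *ℤ y) -ℤ (1ℤ +ℤ k) *ℤ (1ℤ +ℤ k) *ℤ x *ℤ y
      -ℤ (1ℤ +ℤ (1ℤ +ℤ k)) *ℤ y *ℤ (p *ℤ x) +ℤ k *ℤ (1ℤ +ℤ (1ℤ +ℤ k)) *ℤ x *ℤ y
      ≡⟨ solve (k ∷ p ∷ x ∷ y ∷ []) ⟩
    -ℤ ((1ℤ +ℤ p) *ℤ (y *ℤ x)) ∎

Ñ-near-diagonal : ∀ p → Ñ (suc p) p ≗ Ñ p (suc p)
Ñ-near-diagonal p k =
  swap (R p (suc p) k) (R (suc p) p k) (S p (suc p) k) (S (suc p) p k) (R-skew p k) (S-skew p k)
  where
  swap : ∀ r₁ r₂ s₁ s₂ {e} → r₁ -ℤ r₂ ≡ e → s₁ -ℤ s₂ ≡ e → r₂ -ℤ s₂ ≡ r₁ -ℤ s₁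
  swap r₁ r₂ s₁ s₂ refl eₛ = begin
    r₂ -ℤ s₂                               ≡⟨ solve (r₁ ∷ r₂ ∷ s₁ ∷ s₂ ∷ []) ⟩
    (r₁ -ℤ s₁) -ℤ (r₁ -ℤ r₂) +ℤ (s₁ -ℤ s₂) ≡⟨ cong (λ e → (r₁ -ℤ s₁) -ℤ e +ℤ (s₁ -ℤ s₂)) eₛ ⟨
    (r₁ -ℤ s₁) -ℤ (s₁ -ℤ s₂) +ℤ (s₁ -ℤ s₂) ≡⟨ solve (r₁ ∷ s₁ ∷ s₂ ∷ []) ⟩
    r₁ -ℤ s₁                               ∎

N≗Ñ : ∀ p q → p ≤ q → N p q ≗ Ñ p q
N≗Ñ zero    q       _         k = sym (Ñ-zeroˡ q k)
N≗Ñ (suc p) (suc q) (s≤s p≤q) k = begin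
  N (suc p) (suc q) k                               ≡⟨ N-step p q k ⟩
  Nstep p q (N p (suc q)) (N (suc p) q) (N p q) k   ≡⟨ Nstep-cong p q (N≗Ñ p (suc q) (ℕ.m≤n⇒m≤1+n p≤q))
                                                                       (below (ℕ.m≤n⇒m<n∨m≡n p≤q)) (N≗Ñ p q p≤q) k ⟩
  Nstep p q (Ñ p (suc q)) (Ñ (suc p) q) (Ñ p q) k   ≡⟨ Ñ-step p≤q k ⟨
  Ñ (suc p) (suc q) k                               ∎
  where
  below : p < q ⊎ p ≡ q → N (suc p) q ≗ Ñ (suc p) q
  below (inj₁ p<q)  = N≗Ñ (suc p) q p<q
  below (inj₂ refl) = λ k → trans (N-sym (suc p) p k)
                          (trans (N≗Ñ p (suc p) (ℕ.n≤1+n p) k) (sym (Ñ-near-diagonal p k)))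

vandermonde : ∀ a c r → ∑ (suc r) (λ i → binom a i *ℤ binom c (r ∸ i)) ≡ binom (a + c) r
vandermonde zero    c r = begin
  ∑ (suc r) (λ i → binom 0 i *ℤ binom c (r ∸ i))
    ≡⟨ ∑-sucˡ r _ ⟩
  1ℤ *ℤ binom c r +ℤ ∑ r (λ i → 0ℤ *ℤ binom c (r ∸ suc i))
    ≡⟨ cong₂ _+ℤ_ (ℤ.*-identityˡ (binom c r)) (∑-zero r (λ _ _ → refl)) ⟩
  binom c r +ℤ 0ℤ
    ≡⟨ ℤ.+-identityʳ (binom c r) ⟩
  binom c r ∎
vandermonde (suc a) c r = begin
  ∑ (suc r) (λ i → binom (suc a) i *ℤ binom c (r ∸ i))
    ≡⟨ ∑-cong (suc r) (λ i → trans (cong (_*ℤ binom c (r ∸ i)) (binom∸-pascal a i 0))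
                                   (ℤ.*-distribʳ-+ (binom c (r ∸ i)) (binom a i) (binom∸ a i 1))) ⟩
  ∑ (suc r) (λ i → binom a i *ℤ binom c (r ∸ i) +ℤ binom∸ a i 1 *ℤ binom c (r ∸ i))
    ≡⟨ ∑-distrib-+ (suc r) _ _ ⟩
  ∑ (suc r) (λ i → binom a i *ℤ binom c (r ∸ i)) +ℤ ∑ (suc r) (λ i → binom∸ a i 1 *ℤ binom c (r ∸ i))
    ≡⟨ cong₂ _+ℤ_ (vandermonde a c r) (trans (∑-sucˡ r _) (ℤ.+-identityˡ _)) ⟩
  binom (a + c) r +ℤ ∑ r (λ i → binom a i *ℤ binom c (r ∸ suc i))
    ≡⟨ shifted r ⟩
  binom (suc a + c) r ∎
  where
  shifted : ∀ r → binom (a + c) r +ℤ ∑ r (λ i → binom a i *ℤ binom c (r ∸ suc i)) ≡ binom (suc (a + c)) r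
  shifted zero    = ℤ.+-identityʳ 1ℤ
  shifted (suc r) = trans (cong (binom (a + c) (suc r) +ℤ_) (vandermonde a c r))
                          (ℤ.+-comm (binom (a + c) (suc r)) (binom (a + c) r))

vandermonde-i : ∀ a c r →
  ∑ (suc (suc r)) (λ i → + i *ℤ (binom a i *ℤ binom c (suc r ∸ i))) ≡ + a *ℤ binom (a ∸ 1 + c) r
vandermonde-i zero    c r =
  trans (∑-sucˡ (suc r) _) (trans (ℤ.+-identityˡ _) (∑-zero (suc r) (λ i _ → ℤ.*-zeroʳ (+ suc i))))
vandermonde-i (suc a) c r = begin
  ∑ (suc (suc r)) (λ i → + i *ℤ (binom (suc a) i *ℤ binom c (suc r ∸ i)))
    ≡⟨ trans (∑-sucˡ (suc r) _) (ℤ.+-identityˡ _) ⟩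
  ∑ (suc r) (λ i → + suc i *ℤ (binom (suc a) (suc i) *ℤ binom c (r ∸ i)))
    ≡⟨ ∑-cong (suc r) absorbed ⟩
  ∑ (suc r) (λ i → + suc a *ℤ (binom a i *ℤ binom c (r ∸ i)))
    ≡⟨ *-distribˡ-∑ (suc r) (+ suc a) _ ⟨
  + suc a *ℤ ∑ (suc r) (λ i → binom a i *ℤ binom c (r ∸ i))
    ≡⟨ cong (+ suc a *ℤ_) (vandermonde a c r) ⟩
  + suc a *ℤ binom (a + c) r ∎
  where
  absorbed : ∀ i → + suc i *ℤ (binom (suc a) (suc i) *ℤ binom c (r ∸ i)) ≡ + suc a *ℤ (binom a i *ℤ binom c (r ∸ i))
  absorbed i = begin
    + suc i *ℤ (binom (suc a) (suc i) *ℤ binom c (r ∸ i)) ≡⟨ ℤ.*-assoc (+ suc i) (binom (suc a) (suc i)) _ ⟨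
    + suc i *ℤ binom (suc a) (suc i) *ℤ binom c (r ∸ i)   ≡⟨ cong (_*ℤ binom c (r ∸ i)) (binom-absorb a i) ⟩
    + suc a *ℤ binom a i *ℤ binom c (r ∸ i)               ≡⟨ ℤ.*-assoc (+ suc a) (binom a i) _ ⟩
    + suc a *ℤ (binom a i *ℤ binom c (r ∸ i))             ∎

vandermonde-i[i-1] : ∀ a c r →
  ∑ (suc (suc (suc r))) (λ i → + i *ℤ (+ i -ℤ 1ℤ) *ℤ (binom a i *ℤ binom c (suc (suc r) ∸ i)))
  ≡ + a *ℤ (+ (a ∸ 1) *ℤ binom (a ∸ 1 ∸ 1 + c) r)
vandermonde-i[i-1] zero    c r =
  trans (∑-sucˡ (suc (suc r)) _)
        (trans (ℤ.+-identityˡ _) (∑-zero (suc (suc r)) (λ i _ → ℤ.*-zeroʳ (+ suc i *ℤ (+ suc i -ℤ 1ℤ)))))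
vandermonde-i[i-1] (suc a) c r = begin
  ∑ (suc (suc (suc r))) (λ i → + i *ℤ (+ i -ℤ 1ℤ) *ℤ (binom (suc a) i *ℤ binom c (suc (suc r) ∸ i)))
    ≡⟨ trans (∑-sucˡ (suc (suc r)) _) (ℤ.+-identityˡ _) ⟩
  ∑ (suc (suc r)) (λ i → + suc i *ℤ (+ suc i -ℤ 1ℤ) *ℤ (binom (suc a) (suc i) *ℤ binom c (suc r ∸ i)))
    ≡⟨ ∑-cong (suc (suc r)) absorbed ⟩
  ∑ (suc (suc r)) (λ i → + suc a *ℤ (+ i *ℤ (binom a i *ℤ binom c (suc r ∸ i))))
    ≡⟨ *-distribˡ-∑ (suc (suc r)) (+ suc a) _ ⟨
  + suc a *ℤ ∑ (suc (suc r)) (λ i → + i *ℤ (binom a i *ℤ binom c (suc r ∸ i)))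
    ≡⟨ cong (+ suc a *ℤ_) (vandermonde-i a c r) ⟩
  + suc a *ℤ (+ a *ℤ binom (a ∸ 1 + c) r) ∎
  where
  absorbed : ∀ i → + suc i *ℤ (+ suc i -ℤ 1ℤ) *ℤ (binom (suc a) (suc i) *ℤ binom c (suc r ∸ i))
                 ≡ + suc a *ℤ (+ i *ℤ (binom a i *ℤ binom c (suc r ∸ i)))
  absorbed i = rearrange (+ suc i) (+ i) (binom (suc a) (suc i)) (binom a i) (binom c (suc r ∸ i)) (+ suc a)
                         (binom-absorb a i)
    where
    rearrange : ∀ i′ i x y z a → i′ *ℤ x ≡ a *ℤ y → i′ *ℤ (1ℤ +ℤ i -ℤ 1ℤ) *ℤ (x *ℤ z) ≡ a *ℤ (i *ℤ (y *ℤ z))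
    rearrange i′ i x y z a e = begin
      i′ *ℤ (1ℤ +ℤ i -ℤ 1ℤ) *ℤ (x *ℤ z) ≡⟨ solve (i′ ∷ i ∷ x ∷ z ∷ []) ⟩
      (i′ *ℤ x) *ℤ (i *ℤ z)             ≡⟨ cong (_*ℤ (i *ℤ z)) e ⟩
      (a *ℤ y) *ℤ (i *ℤ z)              ≡⟨ solve (a ∷ i ∷ y ∷ z ∷ []) ⟩
      a *ℤ (i *ℤ (y *ℤ z))              ∎

∑-shifted-weight : ∀ m (k : ℤ) (f : ℕ → ℤ) →
  ∑ m (λ i → (+ i -ℤ k) *ℤ (+ i -ℤ k -ℤ 1ℤ) *ℤ f i)
  ≡ ∑ m (λ i → + i *ℤ (+ i -ℤ 1ℤ) *ℤ f i) -ℤ (k +ℤ k) *ℤ ∑ m (λ i → + i *ℤ f i) +ℤ k *ℤ (1ℤ +ℤ k) *ℤ ∑ m f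
∑-shifted-weight zero    k f = solve (k ∷ [])
∑-shifted-weight (suc m) k f =
  trans (cong (_+ℤ (+ m -ℤ k) *ℤ (+ m -ℤ k -ℤ 1ℤ) *ℤ f m) (∑-shifted-weight m k f))
        (step (∑ m (λ i → + i *ℤ (+ i -ℤ 1ℤ) *ℤ f i)) (∑ m (λ i → + i *ℤ f i)) (∑ m f) k (+ m) (f m))
  where
  step : ∀ a b c k i x →
    a -ℤ (k +ℤ k) *ℤ b +ℤ k *ℤ (1ℤ +ℤ k) *ℤ c +ℤ (i -ℤ k) *ℤ (i -ℤ k -ℤ 1ℤ) *ℤ x
    ≡ (a +ℤ i *ℤ (i -ℤ 1ℤ) *ℤ x) -ℤ (k +ℤ k) *ℤ (b +ℤ i *ℤ x) +ℤ k *ℤ (1ℤ +ℤ k) *ℤ (c +ℤ x)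
  step = solve-∀

diagonal-summand : ℕ → ℕ → ℕ → ℤ
diagonal-summand n k j = + j *ℤ + suc j *ℤ (binom (suc n) (suc (j + k)) *ℤ binom∸ (suc n) k j)

symmetric-summand : ℕ → ℕ → ℕ → ℤ
symmetric-summand n k i =
  (+ i -ℤ + k) *ℤ (+ i -ℤ + k -ℤ 1ℤ) *ℤ (binom (suc n) i *ℤ binom (suc n) (suc (k + k) ∸ i))

R-diagonal-reindexed : ∀ n k → R n n k ≡ ∑ (suc k) (diagonal-summand n k)
R-diagonal-reindexed n k = begin
  ∑ k (R-summand n n k)                                     ≡⟨ ∑-cong k (R-summand-comm n n k) ⟩
  ∑ k (λ j → diagonal-summand n k (suc j))                  ≡⟨ ℤ.+-identityˡ _ ⟨
  diagonal-summand n k 0 +ℤ ∑ k (λ j → diagonal-summand n k (suc j)) ≡⟨ ∑-sucˡ k (diagonal-summand n k) ⟨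
  ∑ (suc k) (diagonal-summand n k)                          ∎

symmetric-summand-below : ∀ n k j → j ≤ k → symmetric-summand n k (k ∸ j) ≡ diagonal-summand n k j
symmetric-summand-below n k j j≤k = begin
  symmetric-summand n k (k ∸ j)
    ≡⟨ cong₂ (λ i m → (i -ℤ + k) *ℤ (i -ℤ + k -ℤ 1ℤ) *ℤ (binom (suc n) (k ∸ j) *ℤ binom (suc n) m))
             k∸j≡k-j reflected-index ⟩
  ((+ k -ℤ + j) -ℤ + k) *ℤ ((+ k -ℤ + j) -ℤ + k -ℤ 1ℤ) *ℤ (binom (suc n) (k ∸ j) *ℤ binom (suc n) (suc (j + k)))
    ≡⟨ cong (λ y → ((+ k -ℤ + j) -ℤ + k) *ℤ ((+ k -ℤ + j) -ℤ + k -ℤ 1ℤ) *ℤ (y *ℤ binom (suc n) (suc (j + k))))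
            (i≤k⇒binom∸≡binom (suc n) j≤k) ⟨
  ((+ k -ℤ + j) -ℤ + k) *ℤ ((+ k -ℤ + j) -ℤ + k -ℤ 1ℤ) *ℤ (binom∸ (suc n) k j *ℤ binom (suc n) (suc (j + k)))
    ≡⟨ weight (+ k) (+ j) (binom∸ (suc n) k j) (binom (suc n) (suc (j + k))) ⟩
  diagonal-summand n k j ∎
  where
  k∸j≡k-j : + (k ∸ j) ≡ + k -ℤ + j
  k∸j≡k-j = sym (trans (ℤ.m-n≡m⊖n k j) (ℤ.⊖-≥ j≤k))
  reflected-index : suc (k + k) ∸ (k ∸ j) ≡ suc (j + k)
  reflected-index = begin
    suc (k + k) ∸ (k ∸ j)
      ≡⟨ cong (λ m → suc (m + k) ∸ (k ∸ j)) (ℕ.m∸n+n≡m j≤k) ⟨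
    suc ((k ∸ j) + j + k) ∸ (k ∸ j)
      ≡⟨ cong (λ m → suc m ∸ (k ∸ j)) (ℕ.+-assoc (k ∸ j) j k) ⟩
    suc ((k ∸ j) + (j + k)) ∸ (k ∸ j)
      ≡⟨ cong (_∸ (k ∸ j)) (ℕ.+-suc (k ∸ j) (j + k)) ⟨
    (k ∸ j) + suc (j + k) ∸ (k ∸ j)
      ≡⟨ ℕ.m+n∸m≡n (k ∸ j) (suc (j + k)) ⟩
    suc (j + k) ∎
  weight : ∀ k j x y → ((k -ℤ j) -ℤ k) *ℤ ((k -ℤ j) -ℤ k -ℤ 1ℤ) *ℤ (x *ℤ y) ≡ j *ℤ (1ℤ +ℤ j) *ℤ (y *ℤ x)
  weight = solve-∀

symmetric-summand-above : ∀ n k j → j ≤ k → symmetric-summand n k (suc k + j) ≡ diagonal-summand n k j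
symmetric-summand-above n k j j≤k = begin
  symmetric-summand n k (suc k + j)
    ≡⟨ cong₂ (λ i m → c *ℤ (c -ℤ 1ℤ) *ℤ (binom (suc n) (suc i) *ℤ binom (suc n) m))
             (ℕ.+-comm k j) (ℕ.[m+n]∸[m+o]≡n∸o k k j) ⟩
  c *ℤ (c -ℤ 1ℤ) *ℤ (binom (suc n) (suc (j + k)) *ℤ binom (suc n) (k ∸ j))
    ≡⟨ cong (λ y → c *ℤ (c -ℤ 1ℤ) *ℤ (binom (suc n) (suc (j + k)) *ℤ y)) (i≤k⇒binom∸≡binom (suc n) j≤k) ⟨
  c *ℤ (c -ℤ 1ℤ) *ℤ (binom (suc n) (suc (j + k)) *ℤ binom∸ (suc n) k j)
    ≡⟨ weight (+ k) (+ j) (binom (suc n) (suc (j + k)) *ℤ binom∸ (suc n) k j) ⟩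
  diagonal-summand n k j ∎
  where
  c = 1ℤ +ℤ (+ k +ℤ + j) -ℤ + k
  weight : ∀ k j x → (1ℤ +ℤ (k +ℤ j) -ℤ k) *ℤ (1ℤ +ℤ (k +ℤ j) -ℤ k -ℤ 1ℤ) *ℤ x ≡ j *ℤ (1ℤ +ℤ j) *ℤ x
  weight = solve-∀

R-diagonal-doubled : ∀ n k → R n n k +ℤ R n n k ≡ ∑ (suc (suc (k + k))) (symmetric-summand n k)
R-diagonal-doubled n k = begin
  R n n k +ℤ R n n k                               ≡⟨ cong (λ r → r +ℤ r) (R-diagonal-reindexed n k) ⟩
  ∑ (suc k) h +ℤ ∑ (suc k) h                       ≡⟨ cong₂ _+ℤ_ lower upper ⟨
  ∑ (suc k) g +ℤ ∑ (suc k) (λ j → g (suc k + j))   ≡⟨ ∑-split (suc k) (suc k) g ⟨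
  ∑ (suc k + suc k) g                              ≡⟨ cong (λ m → ∑ (suc m) g) (ℕ.+-suc k k) ⟩
  ∑ (suc (suc (k + k))) g                          ∎
  where
  g = symmetric-summand n k
  h = diagonal-summand n k
  lower : ∑ (suc k) g ≡ ∑ (suc k) h
  lower = trans (∑-reverse (suc k) g)
                (∑-cong-< (suc k) (λ j j<1+k → symmetric-summand-below n k j (ℕ.≤-pred j<1+k)))
  upper : ∑ (suc k) (λ j → g (suc k + j)) ≡ ∑ (suc k) h
  upper = ∑-cong-< (suc k) (λ j j<1+k → symmetric-summand-above n k j (ℕ.≤-pred j<1+k))

R-diagonal-moments : ∀ n k →
  R (suc n) (suc n) (suc k) +ℤ R (suc n) (suc n) (suc k)
  ≡ + suc (suc n) *ℤ (+ suc n *ℤ binom (n + suc (suc n)) (k + suc k))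
    -ℤ (+ suc k +ℤ + suc k) *ℤ (+ suc (suc n) *ℤ binom (suc n + suc (suc n)) (suc k + suc k))
    +ℤ + suc k *ℤ + suc (suc k) *ℤ binom (suc (suc n) + suc (suc n)) (suc (suc k + suc k))
R-diagonal-moments n k = begin
  R (suc n) (suc n) (suc k) +ℤ R (suc n) (suc n) (suc k)
    ≡⟨ R-diagonal-doubled (suc n) (suc k) ⟩
  ∑ (suc m) (symmetric-summand (suc n) (suc k))
    ≡⟨ ∑-shifted-weight (suc m) (+ suc k) f ⟩
  ∑ (suc m) (λ i → + i *ℤ (+ i -ℤ 1ℤ) *ℤ f i) -ℤ (+ suc k +ℤ + suc k) *ℤ ∑ (suc m) (λ i → + i *ℤ f i)
    +ℤ + suc k *ℤ + suc (suc k) *ℤ ∑ (suc m) f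
    ≡⟨ cong₂ (λ a b → a -ℤ (+ suc k +ℤ + suc k) *ℤ b +ℤ + suc k *ℤ + suc (suc k) *ℤ ∑ (suc m) f)
             (vandermonde-i[i-1] a a (k + suc k)) (vandermonde-i a a (suc k + suc k)) ⟩
  + a *ℤ (+ suc n *ℤ x) -ℤ (+ suc k +ℤ + suc k) *ℤ (+ a *ℤ y) +ℤ + suc k *ℤ + suc (suc k) *ℤ ∑ (suc m) f
    ≡⟨ cong (λ c → + a *ℤ (+ suc n *ℤ x) -ℤ (+ suc k +ℤ + suc k) *ℤ (+ a *ℤ y) +ℤ + suc k *ℤ + suc (suc k) *ℤ c)
            (vandermonde a a m) ⟩
  + a *ℤ (+ suc n *ℤ x) -ℤ (+ suc k +ℤ + suc k) *ℤ (+ a *ℤ y) +ℤ + suc k *ℤ + suc (suc k) *ℤ binom (a + a) m ∎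
  where
  x = binom (n + suc (suc n)) (k + suc k)
  y = binom (suc n + suc (suc n)) (suc k + suc k)
  a = suc (suc n)
  m = suc (suc k + suc k)
  f = λ i → binom a i *ℤ binom a (m ∸ i)

-- Only after multiplying by 2k + 1 do both absorption identities apply without division.
diagonal-algebra : ∀ n k x y z r →
  r +ℤ r ≡ (1ℤ +ℤ n) *ℤ (n *ℤ x) -ℤ (k +ℤ k) *ℤ ((1ℤ +ℤ n) *ℤ y) +ℤ k *ℤ (1ℤ +ℤ k) *ℤ z →
  (k +ℤ k) *ℤ y ≡ (1ℤ +ℤ (n +ℤ n)) *ℤ x →
  (1ℤ +ℤ (k +ℤ k)) *ℤ z ≡ (1ℤ +ℤ (1ℤ +ℤ (n +ℤ n))) *ℤ y →
  ((1ℤ +ℤ (n +ℤ n)) +ℤ (1ℤ +ℤ (n +ℤ n))) *ℤ r *ℤ (1ℤ +ℤ (k +ℤ k)) ≡ k *ℤ (n -ℤ k) *ℤ z *ℤ (1ℤ +ℤ (k +ℤ k))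
diagonal-algebra n k x y z r eᵣ eₓ e_z = begin
  ((1ℤ +ℤ (n +ℤ n)) +ℤ (1ℤ +ℤ (n +ℤ n))) *ℤ r *ℤ (1ℤ +ℤ (k +ℤ k))
    ≡⟨ solve (n ∷ k ∷ r ∷ []) ⟩
  (1ℤ +ℤ (n +ℤ n)) *ℤ (r +ℤ r) *ℤ (1ℤ +ℤ (k +ℤ k))
    ≡⟨ cong (λ s → (1ℤ +ℤ (n +ℤ n)) *ℤ s *ℤ (1ℤ +ℤ (k +ℤ k))) eᵣ ⟩
  (1ℤ +ℤ (n +ℤ n)) *ℤ ((1ℤ +ℤ n) *ℤ (n *ℤ x) -ℤ (k +ℤ k) *ℤ ((1ℤ +ℤ n) *ℤ y) +ℤ k *ℤ (1ℤ +ℤ k) *ℤ z)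
    *ℤ (1ℤ +ℤ (k +ℤ k))
    ≡⟨ solve (n ∷ k ∷ x ∷ y ∷ z ∷ []) ⟩
  (1ℤ +ℤ (k +ℤ k)) *ℤ (1ℤ +ℤ n) *ℤ n *ℤ ((1ℤ +ℤ (n +ℤ n)) *ℤ x)
    -ℤ (1ℤ +ℤ (n +ℤ n)) *ℤ (1ℤ +ℤ (k +ℤ k)) *ℤ (1ℤ +ℤ n) *ℤ ((k +ℤ k) *ℤ y)
    +ℤ (1ℤ +ℤ (n +ℤ n)) *ℤ k *ℤ (1ℤ +ℤ k) *ℤ ((1ℤ +ℤ (k +ℤ k)) *ℤ z)
    ≡⟨ cong₂ (λ a b → (1ℤ +ℤ (k +ℤ k)) *ℤ (1ℤ +ℤ n) *ℤ n *ℤ a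
                       -ℤ (1ℤ +ℤ (n +ℤ n)) *ℤ (1ℤ +ℤ (k +ℤ k)) *ℤ (1ℤ +ℤ n) *ℤ ((k +ℤ k) *ℤ y)
                       +ℤ (1ℤ +ℤ (n +ℤ n)) *ℤ k *ℤ (1ℤ +ℤ k) *ℤ b) (sym eₓ) e_z ⟩
  (1ℤ +ℤ (k +ℤ k)) *ℤ (1ℤ +ℤ n) *ℤ n *ℤ ((k +ℤ k) *ℤ y)
    -ℤ (1ℤ +ℤ (n +ℤ n)) *ℤ (1ℤ +ℤ (k +ℤ k)) *ℤ (1ℤ +ℤ n) *ℤ ((k +ℤ k) *ℤ y)
    +ℤ (1ℤ +ℤ (n +ℤ n)) *ℤ k *ℤ (1ℤ +ℤ k) *ℤ ((1ℤ +ℤ (1ℤ +ℤ (n +ℤ n))) *ℤ y)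
    ≡⟨ solve (n ∷ k ∷ y ∷ []) ⟩
  k *ℤ (n -ℤ k) *ℤ ((1ℤ +ℤ (1ℤ +ℤ (n +ℤ n))) *ℤ y)
    ≡⟨ cong (k *ℤ (n -ℤ k) *ℤ_) e_z ⟨
  k *ℤ (n -ℤ k) *ℤ ((1ℤ +ℤ (k +ℤ k)) *ℤ z)
    ≡⟨ solve (n ∷ k ∷ z ∷ []) ⟩
  k *ℤ (n -ℤ k) *ℤ z *ℤ (1ℤ +ℤ (k +ℤ k)) ∎

R-diagonal-value : ∀ n k → + (4 * suc n + 2) *ℤ R (suc n) (suc n) (suc k)
  ≡ + suc k *ℤ (+ suc n -ℤ + suc k) *ℤ binom (2 * suc n + 2) (2 * suc k + 1)
R-diagonal-value n k =
  ℤ.*-cancelʳ-≡ _ _ (+ suc (suc k + suc k))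
    (trans (cong (λ m → + m *ℤ r *ℤ + suc (suc k + suc k)) (width (suc n)))
    (trans (diagonal-algebra (+ suc n) (+ suc k) x y z r (R-diagonal-moments n k) eₓ e_z)
           (cong₂ (λ a b → + suc k *ℤ (+ suc n -ℤ + suc k) *ℤ binom a b *ℤ + suc (suc k + suc k))
                  (double+2 (suc n)) (double+1 (suc k)))))
  where
  r = R (suc n) (suc n) (suc k)
  x = binom (n + suc (suc n)) (k + suc k)
  y = binom (suc n + suc (suc n)) (suc k + suc k)
  z = binom (suc (suc n) + suc (suc n)) (suc (suc k + suc k))
  shift : n + suc (suc n) ≡ suc (n + suc n)
  shift = ℕ.+-suc n (suc n)
  eₓ : (+ suc k +ℤ + suc k) *ℤ y ≡ + suc (suc n + suc n) *ℤ x
  eₓ = trans (binom-absorb (n + suc (suc n)) (k + suc k)) (cong (λ m → + suc m *ℤ x) shift)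
  e_z : + suc (suc k + suc k) *ℤ z ≡ + suc (suc (suc n + suc n)) *ℤ y
  e_z = trans (binom-absorb (suc n + suc (suc n)) (suc k + suc k)) (cong (λ m → + suc (suc m) *ℤ y) shift)
  width : ∀ n → 4 * n + 2 ≡ suc (n + n) + suc (n + n)
  width = solve-∀-ℕ
  double+2 : ∀ n → suc n + suc n ≡ 2 * n + 2
  double+2 = solve-∀-ℕ
  double+1 : ∀ k → suc (k + k) ≡ 2 * k + 1
  double+1 = solve-∀-ℕ

S-diagonal : ∀ n → S n n ≗ 0ₚ
S-diagonal n k = commutator (triangle k) (binom n (suc k)) (binom (suc n) (suc k))
  where
  commutator : ∀ t a c → t *ℤ (a *ℤ c -ℤ c *ℤ a) ≡ 0ℤ
  commutator = solve-∀

Ñ-diagonal : ∀ n k → + (4 * suc n + 2) *ℤ Ñ (suc n) (suc n) k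
  ≡ + k *ℤ (+ suc n -ℤ + k) *ℤ binom (2 * suc n + 2) (2 * k + 1)
Ñ-diagonal n zero    = ℤ.*-zeroʳ (+ (4 * suc n + 2))
Ñ-diagonal n (suc k) =
  trans (cong (+ (4 * suc n + 2) *ℤ_) Ñ≡R) (R-diagonal-value n k)
  where
  Ñ≡R : Ñ (suc n) (suc n) (suc k) ≡ R (suc n) (suc n) (suc k)
  Ñ≡R = trans (cong (λ s → R (suc n) (suc n) (suc k) -ℤ s) (S-diagonal (suc n) (suc k)))
              (ℤ.+-identityʳ (R (suc n) (suc n) (suc k)))

rhsCoeff-untruncated : ∀ n k → rhsCoeff n k ≡ + (k * (n ∸ k) * ((2 * n + 2) C (2 * k + 1)))
rhsCoeff-untruncated n zero    = refl
rhsCoeff-untruncated n (suc k) with suc k ≤ᵇ n ∸ 1 in eq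
... | true  = refl
... | false = cong +_ (sym (trans (cong (λ d → suc k * d * ((2 * n + 2) C (2 * suc k + 1))) n∸k≡0)
                                  (cong (_* ((2 * n + 2) C (2 * suc k + 1))) (ℕ.*-zeroʳ (suc k)))))
  where
  n∸1≤k : n ∸ 1 ≤ k
  n∸1≤k = ℕ.≤-pred (ℕ.≰⇒> (λ le → subst T eq (ℕ.≤⇒≤ᵇ le)))
  n∸k≡0 : n ∸ suc k ≡ 0
  n∸k≡0 = ℕ.m≤n⇒m∸n≡0 (ℕ.≤-trans (ℕ.m≤n+m∸n n 1) (s≤s n∸1≤k))

k[n-k]binom≡k[n∸k]C : ∀ n k → + k *ℤ (+ n -ℤ + k) *ℤ binom (2 * n + 2) (2 * k + 1)
  ≡ + (k * (n ∸ k) * ((2 * n + 2) C (2 * k + 1)))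
k[n-k]binom≡k[n∸k]C n k with k ≤? n
... | yes k≤n = begin
  + k *ℤ (+ n -ℤ + k) *ℤ binom (2 * n + 2) (2 * k + 1)
    ≡⟨ cong₂ (λ d b → + k *ℤ d *ℤ b) (trans (ℤ.m-n≡m⊖n n k) (ℤ.⊖-≥ k≤n)) (binom≡C (2 * n + 2) (2 * k + 1)) ⟩
  + k *ℤ + (n ∸ k) *ℤ + ((2 * n + 2) C (2 * k + 1))
    ≡⟨ cong (_*ℤ + ((2 * n + 2) C (2 * k + 1))) (ℤ.pos-* k (n ∸ k)) ⟨
  + (k * (n ∸ k)) *ℤ + ((2 * n + 2) C (2 * k + 1))
    ≡⟨ ℤ.pos-* (k * (n ∸ k)) ((2 * n + 2) C (2 * k + 1)) ⟨
  + (k * (n ∸ k) * ((2 * n + 2) C (2 * k + 1))) ∎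
... | no k≰n = trans (cong (+ k *ℤ (+ n -ℤ + k) *ℤ_) (n<k⇒binom≡0 too-big))
                     (trans (ℤ.*-zeroʳ (+ k *ℤ (+ n -ℤ + k)))
                            (cong +_ (sym (trans (cong (λ d → k * d * ((2 * n + 2) C (2 * k + 1))) n∸k≡0)
                                                 (cong (_* ((2 * n + 2) C (2 * k + 1))) (ℕ.*-zeroʳ k))))))
  where
  n<k : n < k
  n<k = ℕ.≰⇒> k≰n
  n∸k≡0 : n ∸ k ≡ 0
  n∸k≡0 = ℕ.m≤n⇒m∸n≡0 (ℕ.<⇒≤ n<k)
  too-big : 2 * n + 2 < 2 * k + 1
  too-big = ℕ.≤-trans (ℕ.≤-reflexive (reindex n)) (ℕ.+-monoˡ-≤ 1 (ℕ.*-monoʳ-≤ 2 n<k))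
    where
    reindex : ∀ n → suc (2 * n + 2) ≡ 2 * suc n + 1
    reindex = solve-∀-ℕ

theorem4p1 : (n : ℕ) → n ≥ 1 → (k : ℕ) →
    (+ (4 * n + 2)) *ℤ Nₙ n k ≡ rhsCoeff n k
theorem4p1 (suc n) _ k = begin
  + (4 * suc n + 2) *ℤ N (suc n) (suc n) k
    ≡⟨ cong (+ (4 * suc n + 2) *ℤ_) (N≗Ñ (suc n) (suc n) ℕ.≤-refl k) ⟩
  + (4 * suc n + 2) *ℤ Ñ (suc n) (suc n) k
    ≡⟨ Ñ-diagonal n k ⟩
  + k *ℤ (+ suc n -ℤ + k) *ℤ binom (2 * suc n + 2) (2 * k + 1)
    ≡⟨ k[n-k]binom≡k[n∸k]C (suc n) k ⟩
  + (k * (suc n ∸ k) * ((2 * suc n + 2) C (2 * k + 1)))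
    ≡⟨ rhsCoeff-untruncated (suc n) k ⟨
  rhsCoeff (suc n) k ∎
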